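{- Let $(F_r)_{r\in\mathbb{Z}}$ be the Fibonacci numbers and $(\mathcal{F}_r)_{r\in\mathbb{Z}}$ any generalized Fibonacci sequence. Then for all integers $r,s$ and every nonnegative integer $k$, \[ F_s\sum_{j=0}^{k}F_{s+1}^{\,k-j}\mathcal{F}_{r-1+sj}=\mathcal{F}_{r+s(k+1)}-F_{s+1}^{\,k+1}\mathcal{F}_r, \] \[ \sum_{j=0}^{k}(-1)^jF_s^{\,k-j}F_{s+1}^{\,j}\mathcal{F}_{r-k+s+j}=(-1)^kF_{s+1}^{\,k+1}\mathcal{F}_r+F_s^{\,k+1}\mathcal{F}_{r-k-1}, \] and \[ F_s\sum_{j=0}^{k}F_{s-1}^{\,k-j}\mathcal{F}_{r-sk-s+1+sj}=\mathcal{F}_r-F_{s-1}^{\,k+1}\mathcal{F}_{r-(k+1)s}. \]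
   Context: The Fibonacci numbers $(F_r)_{r\in\mathbb{Z}}$ satisfy $F_0=0$, $F_1=1$ and $F_r=F_{r-1}+F_{r-2}$ for all $r\in\mathbb{Z}$. A generalized Fibonacci sequence is any sequence $(\mathcal{F}_r)_{r\in\mathbb{Z}}$ of complex numbers with $\mathcal{F}_r=\mathcal{F}_{r-1}+\mathcal{F}_{r-2}$ for all $r\in\mathbb{Z}$. The convention $0^0=1$ is used. -}

module Defs where

open import Level using (_⊔_)
open import Data.Nat using (ℕ; zero; suc)
open import Data.Integer using (ℤ; +_) renaming (_-_ to _-ℤ_)
open import Data.Product using (_×_)
open import Algebra.Bundles using (CommutativeRing; Semiring)

-- Definitions relative to a commutative ring R (ℂ is the paper's case).
module Fib {c ℓ} (R : CommutativeRing c ℓ) where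
  open CommutativeRing R using (Carrier; _≈_; _+_; 0#; 1#; semiring)
  open import Algebra.Definitions.RawSemiring (Semiring.rawSemiring semiring) public using (_^_)

  IsGenFib : (ℤ → Carrier) → Set ℓ
  IsGenFib f = ∀ (r : ℤ) → f r ≈ f (r -ℤ + 1) + f (r -ℤ + 2)

  IsFibonacci : (ℤ → Carrier) → Set ℓ
  IsFibonacci f = IsGenFib f × (f (+ 0) ≈ 0#) × (f (+ 1) ≈ 1#)

  sumTo : ℕ → (ℕ → Carrier) → Carrier
  sumTo zero    g = g zero
  sumTo (suc k) g = sumTo k g + g (suc k)

{-# OPTIONS --safe #-}
module Submission where

-- A generalized Fibonacci sequence is determined by two consecutive values, and both sides of
-- 𝓕 (s + q) = F (s + 1) 𝓕 q + F s 𝓕 (q - 1) are generalized Fibonacci in s and agree at s = 0, 1.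
-- Along q = m + s j this addition formula says F s 𝓕 (m - 1 + s j) = V (j + 1) - F (s + 1) V j for
-- V j = 𝓕 (m + s j), so the first sum telescopes in Horner form; the third one is the same
-- argument for the variant 𝓕 (s + q) = F (s - 1) 𝓕 q + F s 𝓕 (q + 1). In the second sum the
-- j-th term is (- F (s + 1)) ^ j F s ^ (k - j) (F (s + 1) u (j + 1) + F s u j) with
-- u j = 𝓕 (r - k - 1 + j), so that sum telescopes as well.

open import Defs
open import Data.Nat using (ℕ; _∸_; zero; _≤_; z≤n)
open import Data.Integer using (ℤ; +_; -[1+_]) renaming (_+_ to _+ℤ_; _-_ to _-ℤ_; _*_ to _*ℤ_)
open import Data.Nat using () renaming (suc to sucℕ)
open import Data.Product using (_×_; _,_; proj₁; proj₂)
open import Algebra.Bundles using (CommutativeRing)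

open import Data.Nat.Properties using (+-∸-assoc; n∸n≡0; m≤n⇒m≤1+n; ≤-refl)
import Data.Integer.Tactic.RingSolver as ℤ-Solver
open import Data.List using (_∷_; [])
open import Relation.Binary.PropositionalEquality using (_≡_; cong)
import Data.Integer.Properties as ℤ

ℤ-induction : ∀ {p} (P : ℤ → Set p) → P (+ 0) →
              (∀ i → P i → P (+ 1 +ℤ i)) → (∀ i → P (+ 1 +ℤ i) → P i) → ∀ i → P i
ℤ-induction P P₀ up down (+ zero)      = P₀
ℤ-induction P P₀ up down (+ sucℕ n)    = up (+ n) (ℤ-induction P P₀ up down (+ n))
ℤ-induction P P₀ up down -[1+ zero ]   = down -[1+ 0 ] P₀
ℤ-induction P P₀ up down -[1+ sucℕ n ] = down -[1+ sucℕ n ] (ℤ-induction P P₀ up down -[1+ n ])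

module _ {c ℓ} (R : CommutativeRing c ℓ) where
  open CommutativeRing R
  open Fib R
  open import Relation.Binary.Reasoning.Setoid setoid
  open import Algebra.Properties.Ring ring using (-1*x≈-x)
  open import Algebra.Properties.AbelianGroup +-abelianGroup using (xyx⁻¹≈y)
  open import Algebra.Properties.CommutativeSemigroup *-commutativeSemigroup using (x∙yz≈y∙xz)
  open import Algebra.Solver.Ring.NaturalCoefficients.Default commutativeSemiring
    using (solve; _:+_; _:*_; _:=_)

  reindex : ∀ (f : ℤ → Carrier) {i j} → i ≡ j → f i ≈ f j
  reindex f i≡j = reflexive (cong f i≡j)

  x+y≈z⇒y≈z-x : ∀ {x y z} → x + y ≈ z → y ≈ z - x
  x+y≈z⇒y≈z-x {x} {y} x+y≈z = trans (sym (xyx⁻¹≈y x y)) (+-congʳ x+y≈z)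

  ^-∸-suc : ∀ a {j k} → j ≤ k → a ^ (sucℕ k ∸ j) ≈ a * a ^ (k ∸ j)
  ^-∸-suc a j≤k = reflexive (cong (a ^_) (+-∸-assoc 1 j≤k))

  sumTo-cong : ∀ k {g h : ℕ → Carrier} → (∀ j → j ≤ k → g j ≈ h j) → sumTo k g ≈ sumTo k h
  sumTo-cong zero     g≈h = g≈h 0 z≤n
  sumTo-cong (sucℕ k) g≈h =
    +-cong (sumTo-cong k (λ j j≤k → g≈h j (m≤n⇒m≤1+n j≤k))) (g≈h (sucℕ k) ≤-refl)

  *-distribˡ-sumTo : ∀ a k (g : ℕ → Carrier) → a * sumTo k g ≈ sumTo k (λ j → a * g j)
  *-distribˡ-sumTo a zero     g = refl
  *-distribˡ-sumTo a (sucℕ k) g = trans (distribˡ a _ _) (+-congʳ (*-distribˡ-sumTo a k g))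

  sumTo-horner : ∀ a (t V : ℕ → Carrier) → (∀ j → a * V j + t j ≈ V (sucℕ j)) →
    ∀ k → a ^ sucℕ k * V 0 + sumTo k (λ j → a ^ (k ∸ j) * t j) ≈ V (sucℕ k)
  sumTo-horner a t V step zero =
    trans (+-cong (*-congʳ (*-identityʳ a)) (*-identityˡ (t 0))) (step 0)
  sumTo-horner a t V step (sucℕ k) = begin
    a * a ^ sucℕ k * V 0 + (sumTo k (λ j → a ^ (sucℕ k ∸ j) * t j) + a ^ (k ∸ k) * t (sucℕ k))
      ≈⟨ +-congˡ (+-cong factor-a last) ⟩
    a * a ^ sucℕ k * V 0 + (a * sumTo k (λ j → a ^ (k ∸ j) * t j) + t (sucℕ k))
      ≈⟨ solve 5 (λ a p v s t → a :* p :* v :+ (a :* s :+ t) := a :* (p :* v :+ s) :+ t)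
               refl a (a ^ sucℕ k) (V 0) (sumTo k (λ j → a ^ (k ∸ j) * t j)) (t (sucℕ k)) ⟩
    a * (a ^ sucℕ k * V 0 + sumTo k (λ j → a ^ (k ∸ j) * t j)) + t (sucℕ k)
      ≈⟨ +-congʳ (*-congˡ (sumTo-horner a t V step k)) ⟩
    a * V (sucℕ k) + t (sucℕ k)
      ≈⟨ step (sucℕ k) ⟩
    V (sucℕ (sucℕ k)) ∎
    where
    factor-a : sumTo k (λ j → a ^ (sucℕ k ∸ j) * t j) ≈ a * sumTo k (λ j → a ^ (k ∸ j) * t j)
    factor-a = trans (sumTo-cong k (λ j j≤k → trans (*-congʳ (^-∸-suc a j≤k)) (*-assoc a _ _)))
                     (sym (*-distribˡ-sumTo a k _))
    last : a ^ (k ∸ k) * t (sucℕ k) ≈ t (sucℕ k)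
    last = trans (*-congʳ (reflexive (cong (a ^_) (n∸n≡0 k)))) (*-identityˡ _)

  sumTo-alternating : ∀ x y (u w : ℕ → Carrier) → (∀ j → w j ≈ x * u (sucℕ j) + y * u j) →
    ∀ k → sumTo k (λ j → (- 1#) ^ j * y ^ (k ∸ j) * x ^ j * w j)
          ≈ (- 1#) ^ k * x ^ sucℕ k * u (sucℕ k) + y ^ sucℕ k * u 0
  sumTo-alternating x y u w w≈ zero = begin
    1# * 1# * 1# * w 0
      ≈⟨ trans (*-congʳ (trans (*-identityʳ _) (*-identityʳ _))) (*-identityˡ _) ⟩
    w 0
      ≈⟨ w≈ 0 ⟩
    x * u 1 + y * u 0
      ≈⟨ sym (+-cong (*-congʳ (trans (*-identityˡ _) (*-identityʳ x))) (*-congʳ (*-identityʳ y))) ⟩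
    1# * (x * 1#) * u 1 + y * 1# * u 0 ∎
  sumTo-alternating x y u w w≈ (sucℕ k) = begin
    sumTo k (λ j → (- 1#) ^ j * y ^ (sucℕ k ∸ j) * x ^ j * w j) + σ′ * y ^ (k ∸ k) * X * w (sucℕ k)
      ≈⟨ +-cong factor-y (*-congʳ (*-congʳ (trans (*-congˡ (reflexive (cong (y ^_) (n∸n≡0 k))))
                                                   (*-identityʳ σ′)))) ⟩
    y * sumTo k (λ j → (- 1#) ^ j * y ^ (k ∸ j) * x ^ j * w j) + σ′ * X * w (sucℕ k)
      ≈⟨ +-cong (*-congˡ (sumTo-alternating x y u w w≈ k)) (*-congˡ (w≈ (sucℕ k))) ⟩
    y * (σ * X * u (sucℕ k) + y ^ sucℕ k * u 0) + σ′ * X * (x * u (sucℕ (sucℕ k)) + y * u (sucℕ k))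
      -- σ′ = - 1# * σ, so the mixed terms cancel
      ≈⟨ solve 9 (λ n σ x X y Y u₀ u₁ u₂ →
                    y :* (σ :* X :* u₁ :+ Y :* u₀) :+ n :* σ :* X :* (x :* u₂ :+ y :* u₁)
                 := (n :* σ :* (x :* X) :* u₂ :+ y :* Y :* u₀) :+ y :* X :* u₁ :* (σ :+ n :* σ))
               refl (- 1#) σ x X y (y ^ sucℕ k) (u 0) (u (sucℕ k)) (u (sucℕ (sucℕ k))) ⟩
    σ′ * (x * X) * u (sucℕ (sucℕ k)) + y * y ^ sucℕ k * u 0 + y * X * u (sucℕ k) * (σ + σ′)
      ≈⟨ +-congˡ (trans (*-congˡ (trans (+-congˡ (-1*x≈-x σ)) (-‿inverseʳ σ))) (zeroʳ _)) ⟩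
    σ′ * (x * X) * u (sucℕ (sucℕ k)) + y * y ^ sucℕ k * u 0 + 0#
      ≈⟨ +-identityʳ _ ⟩
    σ′ * (x * X) * u (sucℕ (sucℕ k)) + y * y ^ sucℕ k * u 0 ∎
    where
    σ σ′ X : Carrier
    σ  = (- 1#) ^ k
    σ′ = (- 1#) ^ sucℕ k
    X  = x ^ sucℕ k
    factor-y : sumTo k (λ j → (- 1#) ^ j * y ^ (sucℕ k ∸ j) * x ^ j * w j)
             ≈ y * sumTo k (λ j → (- 1#) ^ j * y ^ (k ∸ j) * x ^ j * w j)
    factor-y = trans (sumTo-cong k (λ j j≤k → trans (*-congʳ (*-congʳ (*-congˡ (^-∸-suc y j≤k))))
                        (solve 5 (λ e y p q w → e :* (y :* p) :* q :* w := y :* (e :* p :* q :* w))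
                               refl ((- 1#) ^ j) y (y ^ (k ∸ j)) (x ^ j) (w j))))
                     (sym (*-distribˡ-sumTo y k _))

  sumTo-progression : ∀ (f : ℤ → Carrier) a b d s → (∀ q → f (s +ℤ q) ≈ a * f q + b * f (q +ℤ d)) →
    ∀ m k → a ^ sucℕ k * f m + b * sumTo k (λ j → a ^ (k ∸ j) * f (m +ℤ d +ℤ s *ℤ + j))
            ≈ f (m +ℤ s *ℤ + sucℕ k)
  sumTo-progression f a b d s f-add m k = begin
    a ^ sucℕ k * f m + b * sumTo k (λ j → a ^ (k ∸ j) * f (m +ℤ d +ℤ s *ℤ + j))
      ≈⟨ +-cong (*-congˡ (reindex f m≡m+s*0))
                (trans (*-distribˡ-sumTo b k _) (sumTo-cong k (λ j _ → x∙yz≈y∙xz b _ _))) ⟩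
    a ^ sucℕ k * V 0 + sumTo k (λ j → a ^ (k ∸ j) * (b * f (m +ℤ d +ℤ s *ℤ + j)))
      ≈⟨ sumTo-horner a (λ j → b * f (m +ℤ d +ℤ s *ℤ + j)) V (λ j → step (+ j)) k ⟩
    V (sucℕ k) ∎
    where
    V : ℕ → Carrier
    V j = f (m +ℤ s *ℤ + j)
    m≡m+s*0 : m ≡ m +ℤ s *ℤ + 0
    m≡m+s*0 = ℤ-Solver.solve (s ∷ m ∷ [])
    step : ∀ x → a * f (m +ℤ s *ℤ x) + b * f (m +ℤ d +ℤ s *ℤ x) ≈ f (m +ℤ s *ℤ (+ 1 +ℤ x))
    step x = begin
      a * f (m +ℤ s *ℤ x) + b * f (m +ℤ d +ℤ s *ℤ x)
        ≈⟨ +-congˡ (*-congˡ (reindex f m+d+sx≡m+sx+d)) ⟩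
      a * f (m +ℤ s *ℤ x) + b * f (m +ℤ s *ℤ x +ℤ d)
        ≈⟨ sym (f-add (m +ℤ s *ℤ x)) ⟩
      f (s +ℤ (m +ℤ s *ℤ x))
        ≈⟨ reindex f s+[m+sx]≡m+s[1+x] ⟩
      f (m +ℤ s *ℤ (+ 1 +ℤ x)) ∎
      where
      m+d+sx≡m+sx+d : m +ℤ d +ℤ s *ℤ x ≡ m +ℤ s *ℤ x +ℤ d
      m+d+sx≡m+sx+d = ℤ-Solver.solve (d ∷ s ∷ m ∷ x ∷ [])
      s+[m+sx]≡m+s[1+x] : s +ℤ (m +ℤ s *ℤ x) ≡ m +ℤ s *ℤ (+ 1 +ℤ x)
      s+[m+sx]≡m+s[1+x] = ℤ-Solver.solve (s ∷ m ∷ x ∷ [])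

  genFib-recurrence : ∀ {f} → IsGenFib f → ∀ i → f (+ 1 +ℤ (+ 1 +ℤ i)) ≈ f (+ 1 +ℤ i) + f i
  genFib-recurrence {f} f-gen i =
    trans (f-gen _) (+-cong (reindex f [2+i]-1≡1+i) (reindex f [2+i]-2≡i))
    where
    [2+i]-1≡1+i : + 1 +ℤ (+ 1 +ℤ i) -ℤ + 1 ≡ + 1 +ℤ i
    [2+i]-1≡1+i = ℤ-Solver.solve (i ∷ [])
    [2+i]-2≡i : + 1 +ℤ (+ 1 +ℤ i) -ℤ + 2 ≡ i
    [2+i]-2≡i = ℤ-Solver.solve (i ∷ [])

  IsGenFib-shift : ∀ {f} → IsGenFib f → ∀ r → IsGenFib (λ i → f (i +ℤ r))
  IsGenFib-shift {f} f-gen r t =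
    trans (f-gen _) (+-cong (reindex f (t+r-x≡t-x+r (+ 1))) (reindex f (t+r-x≡t-x+r (+ 2))))
    where
    t+r-x≡t-x+r : ∀ x → t +ℤ r -ℤ x ≡ t -ℤ x +ℤ r
    t+r-x≡t-x+r x = ℤ-Solver.solve (t ∷ r ∷ x ∷ [])

  IsGenFib-linear : ∀ {f g} → IsGenFib f → IsGenFib g → ∀ a b → IsGenFib (λ i → f i * a + g i * b)
  IsGenFib-linear {f} {g} f-gen g-gen a b t = begin
    f t * a + g t * b
      ≈⟨ +-cong (*-congʳ (f-gen t)) (*-congʳ (g-gen t)) ⟩
    (f (t -ℤ + 1) + f (t -ℤ + 2)) * a + (g (t -ℤ + 1) + g (t -ℤ + 2)) * b
      ≈⟨ solve 6 (λ f₁ f₂ g₁ g₂ a b → (f₁ :+ f₂) :* a :+ (g₁ :+ g₂) :* b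
                                     := (f₁ :* a :+ g₁ :* b) :+ (f₂ :* a :+ g₂ :* b))
               refl (f (t -ℤ + 1)) (f (t -ℤ + 2)) (g (t -ℤ + 1)) (g (t -ℤ + 2)) a b ⟩
    (f (t -ℤ + 1) * a + g (t -ℤ + 1) * b) + (f (t -ℤ + 2) * a + g (t -ℤ + 2) * b) ∎

  IsGenFib-unique : ∀ {f g} → IsGenFib f → IsGenFib g → f (+ 0) ≈ g (+ 0) → f (+ 1) ≈ g (+ 1) →
    ∀ i → f i ≈ g i
  IsGenFib-unique {f} {g} f-gen g-gen f₀≈g₀ f₁≈g₁ i =
    proj₁ (ℤ-induction P (f₀≈g₀ , f₁≈g₁) up down i)
    where
    P : ℤ → Set ℓ
    P i = f i ≈ g i × f (+ 1 +ℤ i) ≈ g (+ 1 +ℤ i)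
    up : ∀ i → P i → P (+ 1 +ℤ i)
    up i (fᵢ≈gᵢ , fᵢ₊₁≈gᵢ₊₁) = fᵢ₊₁≈gᵢ₊₁ ,
      trans (genFib-recurrence f-gen i) (trans (+-cong fᵢ₊₁≈gᵢ₊₁ fᵢ≈gᵢ) (sym (genFib-recurrence g-gen i)))
    down : ∀ i → P (+ 1 +ℤ i) → P i
    down i (fᵢ₊₁≈gᵢ₊₁ , fᵢ₊₂≈gᵢ₊₂) =
      trans (x+y≈z⇒y≈z-x (sym (genFib-recurrence f-gen i)))
        (trans (+-cong fᵢ₊₂≈gᵢ₊₂ (-‿cong fᵢ₊₁≈gᵢ₊₁))
               (sym (x+y≈z⇒y≈z-x (sym (genFib-recurrence g-gen i))))) ,
      fᵢ₊₁≈gᵢ₊₁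

  module _ {F 𝓕 : ℤ → Carrier} (F-fib : IsFibonacci F) (𝓕-gen : IsGenFib 𝓕) where

    F-gen : IsGenFib F
    F-gen = proj₁ F-fib

    F₀≈0 : F (+ 0) ≈ 0#
    F₀≈0 = proj₁ (proj₂ F-fib)

    F₁≈1 : F (+ 1) ≈ 1#
    F₁≈1 = proj₂ (proj₂ F-fib)

    F₂≈1 : F (+ 2) ≈ 1#
    F₂≈1 = trans (F-gen (+ 2)) (trans (+-cong F₁≈1 F₀≈0) (+-identityʳ 1#))

    genFib-addition : ∀ s q → 𝓕 (s +ℤ q) ≈ F (s +ℤ + 1) * 𝓕 q + F s * 𝓕 (q -ℤ + 1)
    genFib-addition s q = IsGenFib-unique (IsGenFib-shift 𝓕-gen q)
      (IsGenFib-linear (IsGenFib-shift F-gen (+ 1)) F-gen (𝓕 q) (𝓕 (q -ℤ + 1))) at-0 at-1 s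
      where
      at-0 : 𝓕 (+ 0 +ℤ q) ≈ F (+ 1) * 𝓕 q + F (+ 0) * 𝓕 (q -ℤ + 1)
      at-0 = begin
        𝓕 (+ 0 +ℤ q)                             ≈⟨ reindex 𝓕 (ℤ.+-identityˡ q) ⟩
        𝓕 q                                      ≈⟨ sym (+-identityʳ _) ⟩
        𝓕 q + 0#                                 ≈⟨ sym (+-cong (*-identityˡ _) (zeroˡ _)) ⟩
        1# * 𝓕 q + 0# * 𝓕 (q -ℤ + 1)            ≈⟨ sym (+-cong (*-congʳ F₁≈1) (*-congʳ F₀≈0)) ⟩
        F (+ 1) * 𝓕 q + F (+ 0) * 𝓕 (q -ℤ + 1) ∎
      at-1 : 𝓕 (+ 1 +ℤ q) ≈ F (+ 2) * 𝓕 q + F (+ 1) * 𝓕 (q -ℤ + 1)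
      at-1 = begin
        𝓕 (+ 1 +ℤ q)                             ≈⟨ 𝓕-gen _ ⟩
        𝓕 (+ 1 +ℤ q -ℤ + 1) + 𝓕 (+ 1 +ℤ q -ℤ + 2)
          ≈⟨ +-cong (reindex 𝓕 [1+q]-1≡q) (reindex 𝓕 [1+q]-2≡q-1) ⟩
        𝓕 q + 𝓕 (q -ℤ + 1)                       ≈⟨ sym (+-cong (*-identityˡ _) (*-identityˡ _)) ⟩
        1# * 𝓕 q + 1# * 𝓕 (q -ℤ + 1)            ≈⟨ sym (+-cong (*-congʳ F₂≈1) (*-congʳ F₁≈1)) ⟩
        F (+ 2) * 𝓕 q + F (+ 1) * 𝓕 (q -ℤ + 1) ∎
        where
        [1+q]-1≡q : + 1 +ℤ q -ℤ + 1 ≡ q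
        [1+q]-1≡q = ℤ-Solver.solve (q ∷ [])
        [1+q]-2≡q-1 : + 1 +ℤ q -ℤ + 2 ≡ q -ℤ + 1
        [1+q]-2≡q-1 = ℤ-Solver.solve (q ∷ [])

    genFib-addition′ : ∀ s q → 𝓕 (s +ℤ q) ≈ F (s -ℤ + 1) * 𝓕 q + F s * 𝓕 (q +ℤ + 1)
    genFib-addition′ s q = begin
      𝓕 (s +ℤ q)
        ≈⟨ reindex 𝓕 s+q≡[s-1]+[q+1] ⟩
      𝓕 (s -ℤ + 1 +ℤ (q +ℤ + 1))
        ≈⟨ genFib-addition (s -ℤ + 1) (q +ℤ + 1) ⟩
      F (s -ℤ + 1 +ℤ + 1) * 𝓕 (q +ℤ + 1) + F (s -ℤ + 1) * 𝓕 (q +ℤ + 1 -ℤ + 1)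
        ≈⟨ +-cong (*-congʳ (reindex F s-1+1≡s)) (*-congˡ (reindex 𝓕 q+1-1≡q)) ⟩
      F s * 𝓕 (q +ℤ + 1) + F (s -ℤ + 1) * 𝓕 q
        ≈⟨ +-comm _ _ ⟩
      F (s -ℤ + 1) * 𝓕 q + F s * 𝓕 (q +ℤ + 1) ∎
      where
      s+q≡[s-1]+[q+1] : s +ℤ q ≡ s -ℤ + 1 +ℤ (q +ℤ + 1)
      s+q≡[s-1]+[q+1] = ℤ-Solver.solve (s ∷ q ∷ [])
      s-1+1≡s : s -ℤ + 1 +ℤ + 1 ≡ s
      s-1+1≡s = ℤ-Solver.solve (s ∷ [])
      q+1-1≡q : q +ℤ + 1 -ℤ + 1 ≡ q
      q+1-1≡q = ℤ-Solver.solve (q ∷ [])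

    sum-identity₁ : ∀ r s k →
      F s * sumTo k (λ j → F (s +ℤ + 1) ^ (k ∸ j) * 𝓕 (r -ℤ + 1 +ℤ s *ℤ + j))
        ≈ 𝓕 (r +ℤ s *ℤ + sucℕ k) - F (s +ℤ + 1) ^ sucℕ k * 𝓕 r
    sum-identity₁ r s k =
      -- q -ℤ + 1 unfolds to q +ℤ -[1+ 0 ]
      x+y≈z⇒y≈z-x (sumTo-progression 𝓕 (F (s +ℤ + 1)) (F s) -[1+ 0 ] s (genFib-addition s) r k)

    sum-identity₂ : ∀ r s k →
      sumTo k (λ j → (- 1#) ^ j * F s ^ (k ∸ j) * F (s +ℤ + 1) ^ j * 𝓕 (r -ℤ + k +ℤ s +ℤ + j))
        ≈ (- 1#) ^ k * F (s +ℤ + 1) ^ sucℕ k * 𝓕 r + F s ^ sucℕ k * 𝓕 (r -ℤ + k -ℤ + 1)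
    sum-identity₂ r s k = begin
      sumTo k (λ j → (- 1#) ^ j * F s ^ (k ∸ j) * F (s +ℤ + 1) ^ j * 𝓕 (r -ℤ + k +ℤ s +ℤ + j))
        ≈⟨ sumTo-alternating (F (s +ℤ + 1)) (F s) (λ j → 𝓕 (p +ℤ + j)) (λ j → 𝓕 (r -ℤ + k +ℤ s +ℤ + j))
                             (λ j → w≈ (+ j)) k ⟩
      (- 1#) ^ k * F (s +ℤ + 1) ^ sucℕ k * 𝓕 (p +ℤ + sucℕ k) + F s ^ sucℕ k * 𝓕 (p +ℤ + 0)
        ≈⟨ +-cong (*-congˡ (reindex 𝓕 (r-K-1+[1+K]≡r (+ k)))) (*-congˡ (reindex 𝓕 (ℤ.+-identityʳ p))) ⟩
      (- 1#) ^ k * F (s +ℤ + 1) ^ sucℕ k * 𝓕 r + F s ^ sucℕ k * 𝓕 p ∎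
      where
      p : ℤ
      p = r -ℤ + k -ℤ + 1
      r-K-1+[1+K]≡r : ∀ K → r -ℤ K -ℤ + 1 +ℤ (+ 1 +ℤ K) ≡ r
      r-K-1+[1+K]≡r K = ℤ-Solver.solve (r ∷ K ∷ [])
      r-K+s+x≡s+[r-K-1+[1+x]] : ∀ K x → r -ℤ K +ℤ s +ℤ x ≡ s +ℤ (r -ℤ K -ℤ + 1 +ℤ (+ 1 +ℤ x))
      r-K+s+x≡s+[r-K-1+[1+x]] K x = ℤ-Solver.solve (r ∷ s ∷ K ∷ x ∷ [])
      y+[1+x]-1≡y+x : ∀ y x → y +ℤ (+ 1 +ℤ x) -ℤ + 1 ≡ y +ℤ x
      y+[1+x]-1≡y+x y x = ℤ-Solver.solve (y ∷ x ∷ [])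
      w≈ : ∀ x → 𝓕 (r -ℤ + k +ℤ s +ℤ x) ≈ F (s +ℤ + 1) * 𝓕 (p +ℤ (+ 1 +ℤ x)) + F s * 𝓕 (p +ℤ x)
      w≈ x = begin
        𝓕 (r -ℤ + k +ℤ s +ℤ x)
          ≈⟨ reindex 𝓕 (r-K+s+x≡s+[r-K-1+[1+x]] (+ k) x) ⟩
        𝓕 (s +ℤ (p +ℤ (+ 1 +ℤ x)))
          ≈⟨ genFib-addition s (p +ℤ (+ 1 +ℤ x)) ⟩
        F (s +ℤ + 1) * 𝓕 (p +ℤ (+ 1 +ℤ x)) + F s * 𝓕 (p +ℤ (+ 1 +ℤ x) -ℤ + 1)
          ≈⟨ +-congˡ (*-congˡ (reindex 𝓕 (y+[1+x]-1≡y+x p x))) ⟩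
        F (s +ℤ + 1) * 𝓕 (p +ℤ (+ 1 +ℤ x)) + F s * 𝓕 (p +ℤ x) ∎

    sum-identity₃ : ∀ r s k →
      F s * sumTo k (λ j → F (s -ℤ + 1) ^ (k ∸ j) * 𝓕 (r -ℤ s *ℤ + k -ℤ s +ℤ + 1 +ℤ s *ℤ + j))
        ≈ 𝓕 r - F (s -ℤ + 1) ^ sucℕ k * 𝓕 (r -ℤ + sucℕ k *ℤ s)
    sum-identity₃ r s k = begin
      F s * sumTo k (λ j → F (s -ℤ + 1) ^ (k ∸ j) * 𝓕 (m +ℤ + 1 +ℤ s *ℤ + j))
        ≈⟨ x+y≈z⇒y≈z-x (sumTo-progression 𝓕 (F (s -ℤ + 1)) (F s) (+ 1) s (genFib-addition′ s) m k) ⟩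
      𝓕 (m +ℤ s *ℤ + sucℕ k) - F (s -ℤ + 1) ^ sucℕ k * 𝓕 m
        ≈⟨ +-cong (reindex 𝓕 (m+s[1+K]≡r (+ k))) (-‿cong (*-congˡ (reindex 𝓕 (m≡r-[1+K]s (+ k))))) ⟩
      𝓕 r - F (s -ℤ + 1) ^ sucℕ k * 𝓕 (r -ℤ + sucℕ k *ℤ s) ∎
      where
      m : ℤ
      m = r -ℤ s *ℤ + k -ℤ s
      m+s[1+K]≡r : ∀ K → r -ℤ s *ℤ K -ℤ s +ℤ s *ℤ (+ 1 +ℤ K) ≡ r
      m+s[1+K]≡r K = ℤ-Solver.solve (r ∷ s ∷ K ∷ [])
      m≡r-[1+K]s : ∀ K → r -ℤ s *ℤ K -ℤ s ≡ r -ℤ (+ 1 +ℤ K) *ℤ s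
      m≡r-[1+K]s K = ℤ-Solver.solve (r ∷ s ∷ K ∷ [])

theorem4 : ∀ {c ℓ} (R : CommutativeRing c ℓ) → let open CommutativeRing R in let open Fib R in
    (F 𝓕 : ℤ → Carrier) → IsFibonacci F → IsGenFib 𝓕 →
    (r s : ℤ) (k : ℕ) →
      (F s * sumTo k (λ j → F (s +ℤ + 1) ^ (k ∸ j) * 𝓕 (r -ℤ + 1 +ℤ s *ℤ + j))
        ≈ 𝓕 (r +ℤ s *ℤ + sucℕ k) - F (s +ℤ + 1) ^ sucℕ k * 𝓕 r)
    × (sumTo k (λ j → (- 1#) ^ j * F s ^ (k ∸ j) * F (s +ℤ + 1) ^ j * 𝓕 (r -ℤ + k +ℤ s +ℤ + j))
        ≈ (- 1#) ^ k * F (s +ℤ + 1) ^ sucℕ k * 𝓕 r + F s ^ sucℕ k * 𝓕 (r -ℤ + k -ℤ + 1))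
    × (F s * sumTo k (λ j → F (s -ℤ + 1) ^ (k ∸ j) * 𝓕 (r -ℤ s *ℤ + k -ℤ s +ℤ + 1 +ℤ s *ℤ + j))
        ≈ 𝓕 r - F (s -ℤ + 1) ^ sucℕ k * 𝓕 (r -ℤ + sucℕ k *ℤ s))
theorem4 R F 𝓕 F-fib 𝓕-gen r s k =
  sum-identity₁ R F-fib 𝓕-gen r s k , sum-identity₂ R F-fib 𝓕-gen r s k , sum-identity₃ R F-fib 𝓕-gen r s k
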